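{- Let $\sigma$ be a proper schedule of $J$ and let $\sigma'$ be the intermediate schedule obtained from $\sigma$ by an admissible swap at step $j^*\in J$ between machines $M_h$ and $M_i$, with sets $J_H,J_I$ as in the definition of the swap. Writing $C_j$ and $C'_j$ for the completion time of job $j$ in $\sigma$ and $\sigma'$ respectively, we have $C'_j\le C_{j^*}$ for all $j\in J_H\cup J_I$.
   Context: Setting: $m$ identical parallel machines $M_1,\dots,M_m$ and jobs $J=\{1,\dots,n\}$ (indexed according to some fixed priority ordering); job $j$ has positive integer processing time $p_j$. Let $p_{\max}=\max_j p_j$; for $J'\subseteq J$ let $P(J')=\sum_{j\in J'}p_j$; let $J_j=\{1,\dots,j\}$. A proper schedule $\sigma$ is a partition $J=J_1(\sigma)\cup\dots\cup J_m(\sigma)$ ($J_i(\sigma)$ = jobs on $M_i$), where each machine processes its jobs from time $0$ without idle time in increasing order of index. Let $J_{i,j}(\sigma)=J_i(\sigma)\cap J_j$. In any schedule, each machine processes its jobs in a given sequence without idle time from time $0$, and $C_j$ is the time job $j$ finishes. The swap: let $\sigma$ be a proper schedule, $j^*\in J$, and $h,i\in\{1,\dots,m\}$. The swap is admissible for $\sigma$ at step $j^*$ (with machines $M_h,M_i$) if (i) $j^*\in J_{h}(\sigma)$; (ii) $|J_i(\sigma)\setminus J_{i,j^*}(\sigma)|\ge 2p_{\max}$; (iii) $P(J_{h,j^*}(\sigma))-P(J_{i,j^*}(\sigma))\ge 4p_{\max}^2$. In that case let $J_I$ be the first $2p_{\max}$ jobs (in processing order on $M_i$) of $J_i(\sigma)\setminus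 J_{i,j^*}(\sigma)$ and $J_H$ the last $2p_{\max}$ jobs (in processing order on $M_h$) of $J_{h,j^*}(\sigma)$. Choose nonempty $J_{H'}\subseteq J_H$ and $J_{I'}\subseteq J_I$ with $P(J_{H'})=P(J_{I'})$, and let $J_{H''}=J_H\setminus J_{H'}$, $J_{I''}=J_I\setminus J_{I'}$. The intermediate schedule $\sigma'$ changes only $M_h$ and $M_i$: on $M_h$ the consecutive block $J_H$ is replaced by the jobs of $J_{H''}$ (in their order in $\sigma$) followed by the jobs of $J_{I'}$ (in their order in $\sigma$); on $M_i$ the consecutive block $J_I$ is replaced by the jobs of $J_{H'}$ (in their order in $\sigma$) followed by the jobs of $J_{I''}$ (in their order in $\sigma$); all other jobs keep their machine and relative order, and machines process jobs without idle time. -}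

module Defs where

open import Data.Nat using (ℕ; _+_; _*_; _∸_; _⊔_; _≤_)
open import Data.Fin using (Fin) renaming (_≟_ to _≟ᶠ_; _≤?_ to _≤?ᶠ_; _<?_ to _<?ᶠ_)
open import Data.Bool using (Bool; true) renaming (_≟_ to _≟ᵇ_)
open import Data.List using (List; []; _∷_; _++_; map; foldr; filter; length; take; drop; allFin)
open import Data.Nat.ListAction using (sum)
open import Data.Product using (_×_)
open import Relation.Nullary using (yes; no; ¬_)
open import Relation.Binary.PropositionalEquality using (_≡_)

-- Jobs are Fin n, indexed by the priority ordering (index order).  A proper schedule is an assignment σ : Fin n → Fin m;
-- machine i processes jobs σ⁻¹(i) in increasing index order.
-- A general schedule lists, for each machine, its job sequence.

module _ {n : ℕ} (p : Fin n → ℕ) where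

  P : List (Fin n) → ℕ
  P js = sum (map p js)

  pmax : ℕ
  pmax = foldr _⊔_ 0 (map p (allFin n))

  completion : List (Fin n) → Fin n → ℕ
  completion [] j = 0
  completion (k ∷ ks) j with k ≟ᶠ j
  ... | yes _ = p k
  ... | no _  = p k + completion ks j

module _ {n m : ℕ} (σ : Fin n → Fin m) where

  jobsOn : Fin m → List (Fin n)
  jobsOn i = filter (λ k → σ k ≟ᶠ i) (allFin n)

  jobsUpTo : Fin m → Fin n → List (Fin n)
  jobsUpTo i j = filter (λ k → k ≤?ᶠ j) (jobsOn i)

  jobsAfter : Fin m → Fin n → List (Fin n)
  jobsAfter i j = filter (λ k → j <?ᶠ k) (jobsOn i)

C : {n m : ℕ} → (Fin n → ℕ) → (Fin n → Fin m) → Fin n → ℕ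
C p σ j = completion p (jobsOn σ (σ j)) j

sel : {n : ℕ} → (Fin n → Bool) → List (Fin n) → List (Fin n)
sel S = filter (λ k → S k ≟ᵇ true)

unsel : {n : ℕ} → (Fin n → Bool) → List (Fin n) → List (Fin n)
unsel S = filter (λ k → ¬? (S k ≟ᵇ true))
  where open import Relation.Nullary.Decidable using (¬?)

module Swap {n m : ℕ} (p : Fin n → ℕ) (σ : Fin n → Fin m)
            (j* : Fin n) (h i : Fin m) where

  two-pmax : ℕ
  two-pmax = 2 * pmax p

  -- admissibility conditions (i)-(iii)
  Admissible : Set
  Admissible = (σ j* ≡ h)
             × (two-pmax ≤ length (jobsAfter σ i j*))
             × (P p (jobsUpTo σ i j*) + 4 * (pmax p * pmax p) ≤ P p (jobsUpTo σ h j*))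

  JI : List (Fin n)
  JI = take two-pmax (jobsAfter σ i j*)

  restI : List (Fin n)
  restI = drop two-pmax (jobsAfter σ i j*)

  cutH : ℕ
  cutH = length (jobsUpTo σ h j*) ∸ two-pmax

  prefixH : List (Fin n)
  prefixH = take cutH (jobsUpTo σ h j*)

  JH : List (Fin n)
  JH = drop cutH (jobsUpTo σ h j*)

  -- choice of J_{H'} ⊆ J_H and J_{I'} ⊆ J_I via indicators SH, SI
  module Choice (SH SI : Fin n → Bool) where

    JH' JH'' JI' JI'' : List (Fin n)
    JH'  = sel SH JH
    JH'' = unsel SH JH
    JI'  = sel SI JI
    JI'' = unsel SI JI

    ValidChoice : Set
    ValidChoice = (¬ JH' ≡ []) × (¬ JI' ≡ []) × (P p JH' ≡ P p JI')

    σ' : Fin m → List (Fin n)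
    σ' k with k ≟ᶠ h
    ... | yes _ = prefixH ++ (JH'' ++ JI') ++ jobsAfter σ h j*
    ... | no _ with k ≟ᶠ i
    ...   | yes _ = jobsUpTo σ i j* ++ (JH' ++ JI'') ++ restI
    ...   | no _  = jobsOn σ k

-- On M_h the block J_H is replaced by J_{H''} followed by J_{I'}, of the same total length since
-- P(J_{H'}) = P(J_{I'}); no job of J_H ∪ J_I lies in the tail of M_h after j* (jobs of J_I sit on
-- M_i, and (iii) forces h ≠ i), so on M_h they finish by P(J_{h,j*}) = C_{j*}. On M_i the new block
-- J_{H'} ∪ J_{I''} has at most 4 p_max jobs, hence length at most 4 p_max², so its jobs finish by
-- P(J_{i,j*}) + 4 p_max² ≤ P(J_{h,j*}) = C_{j*}, again by (iii).
{-# OPTIONS --safe #-}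
module Submission where

open import Defs
open import Data.Nat using (ℕ; suc; _≤_; _<_; _+_; _*_; _∸_; _⊔_; z≤n; s≤s)
open import Data.Nat.Properties
open import Data.Nat.ListAction using (sum)
open import Data.Nat.ListAction.Properties using (sum-++)
open import Data.Nat.Solver using (module +-*-Solver)
open import Data.Fin as Fin using (Fin) renaming (_≟_ to _≟ᶠ_; _≤?_ to _≤?ᶠ_; _<?_ to _<?ᶠ_)
import Data.Fin.Properties as Fin
open import Data.Bool using (Bool; true; false)
open import Data.List using (List; []; _∷_; _++_; map; foldr; filter; length; take; drop; allFin)
open import Data.List.Properties using (filter-accept; filter-none; ++-assoc; take++drop≡id; length-drop; length-take; map-++)
open import Data.List.Membership.Propositional using (_∈_; _∉_)
open import Data.List.Membership.Propositional.Properties using (∈-++⁺ˡ; ∈-++⁺ʳ; ∈-++⁻; ∈-map⁺; ∈-allFin; ∈-filter⁺; ∈-filter⁻)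
open import Data.List.Relation.Binary.Subset.Propositional using (_⊆_)
open import Data.List.Relation.Binary.Disjoint.Propositional using (Disjoint)
open import Data.List.Relation.Unary.Unique.Propositional using (Unique)
open import Data.List.Relation.Unary.Any using (here; there)
import Data.List.Relation.Unary.All as All
open import Data.List.Relation.Unary.AllPairs as AllPairs using (AllPairs; _∷_)
import Data.List.Relation.Unary.AllPairs.Properties as AllPairs
open import Data.Product using (_×_; _,_; proj₁; proj₂)
open import Data.Sum as Sum using (_⊎_; inj₁; inj₂; [_,_]′)
open import Data.Empty using (⊥-elim)
open import Function using (id; _∘_)
open import Relation.Nullary using (yes; no)
open import Relation.Binary.PropositionalEquality
open import Algebra.Properties.CommutativeSemigroup +-commutativeSemigroup using (x∙yz≈y∙xz)

≤-foldr-⊔ : ∀ {x} {xs : List ℕ} → x ∈ xs → x ≤ foldr _⊔_ 0 xs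
≤-foldr-⊔ {xs = y ∷ _} (here refl)  = m≤m⊔n y _
≤-foldr-⊔ {xs = y ∷ _} (there x∈xs) = ≤-trans (≤-foldr-⊔ x∈xs) (m≤n⊔m y _)

module _ {A : Set} where

  take⊆ : ∀ k (xs : List A) → take k xs ⊆ xs
  take⊆ k xs x∈ = subst (_ ∈_) (take++drop≡id k xs) (∈-++⁺ˡ x∈)

  drop⊆ : ∀ k (xs : List A) → drop k xs ⊆ xs
  drop⊆ k xs x∈ = subst (_ ∈_) (take++drop≡id k xs) (∈-++⁺ʳ (take k xs) x∈)

  take-drop-disjoint : ∀ k {xs : List A} → Unique xs → Disjoint (take k xs) (drop k xs)
  take-drop-disjoint (suc k) {y ∷ xs} (y∉xs ∷ _) (here refl , y∈) =
    All.lookup y∉xs (drop⊆ k xs y∈) refl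
  take-drop-disjoint (suc k) {y ∷ xs} (_ ∷ unique) (there x∈ , x∈′) =
    take-drop-disjoint k unique (x∈ , x∈′)

  length-drop-∸≤ : ∀ k (xs : List A) → length (drop (length xs ∸ k) xs) ≤ k
  length-drop-∸≤ k xs = begin
    length (drop (L ∸ k) xs) ≡⟨ length-drop (L ∸ k) xs ⟩
    L ∸ (L ∸ k)              ≤⟨ m≤n+o⇒m∸n≤o L (L ∸ k) (subst (L ≤_) (+-comm k (L ∸ k)) (m≤n+m∸n L k)) ⟩
    k                        ∎
    where
    open ≤-Reasoning
    L = length xs

  length-take≤ : ∀ k (xs : List A) → length (take k xs) ≤ k
  length-take≤ k xs = subst (_≤ k) (sym (length-take k xs)) (m⊓n≤m k (length xs))

module _ {n : ℕ} (p : Fin n → ℕ) where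

  P-++ : ∀ xs ys → P p (xs ++ ys) ≡ P p xs + P p ys
  P-++ xs ys = trans (cong sum (map-++ p xs ys)) (sum-++ (map p xs) (map p ys))

  P-sel+P-unsel : ∀ (S : Fin n → Bool) xs → P p (sel S xs) + P p (unsel S xs) ≡ P p xs
  P-sel+P-unsel S [] = refl
  P-sel+P-unsel S (x ∷ xs) with S x
  ... | true  = trans (+-assoc (p x) _ _) (cong (p x +_) (P-sel+P-unsel S xs))
  ... | false = trans (x∙yz≈y∙xz (P p (sel S xs)) (p x) _) (cong (p x +_) (P-sel+P-unsel S xs))

  P-sel≤ : ∀ S xs → P p (sel S xs) ≤ P p xs
  P-sel≤ S xs = subst (P p (sel S xs) ≤_) (P-sel+P-unsel S xs) (m≤m+n _ _)

  P-unsel≤ : ∀ S xs → P p (unsel S xs) ≤ P p xs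
  P-unsel≤ S xs = subst (P p (unsel S xs) ≤_) (P-sel+P-unsel S xs) (m≤n+m _ _)

  p≤pmax : ∀ j → p j ≤ pmax p
  p≤pmax j = ≤-foldr-⊔ (∈-map⁺ p (∈-allFin j))

  P≤length*pmax : ∀ xs → P p xs ≤ length xs * pmax p
  P≤length*pmax []       = z≤n
  P≤length*pmax (x ∷ xs) = +-mono-≤ (p≤pmax x) (P≤length*pmax xs)

  completion-++ˡ : ∀ {j} xs ys → j ∈ xs → completion p (xs ++ ys) j ≡ completion p xs j
  completion-++ˡ {j} (x ∷ xs) ys j∈ with x ≟ᶠ j
  completion-++ˡ (x ∷ xs) ys _           | yes _ = refl
  completion-++ˡ (x ∷ xs) ys (here j≡x)  | no x≢j = ⊥-elim (x≢j (sym j≡x))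
  completion-++ˡ (x ∷ xs) ys (there j∈) | no _   = cong (p x +_) (completion-++ˡ xs ys j∈)

  completion≤P : ∀ {j} xs → j ∈ xs → completion p xs j ≤ P p xs
  completion≤P {j} (x ∷ xs) j∈ with x ≟ᶠ j
  completion≤P (x ∷ xs) _           | yes _ = m≤m+n (p x) (P p xs)
  completion≤P (x ∷ xs) (here j≡x)  | no x≢j = ⊥-elim (x≢j (sym j≡x))
  completion≤P (x ∷ xs) (there j∈) | no _   = +-monoʳ-≤ (p x) (completion≤P xs j∈)

  completion-++-++≤ : ∀ {j} xs A ys → j ∈ xs ++ A ++ ys → j ∉ ys →
                      completion p (xs ++ A ++ ys) j ≤ P p xs + P p A
  completion-++-++≤ {j} xs A ys j∈ j∉ys = begin
    completion p (xs ++ A ++ ys) j   ≡⟨ cong (λ zs → completion p zs j) (sym (++-assoc xs A ys)) ⟩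
    completion p ((xs ++ A) ++ ys) j ≡⟨ completion-++ˡ (xs ++ A) ys j∈xs++A ⟩
    completion p (xs ++ A) j         ≤⟨ completion≤P (xs ++ A) j∈xs++A ⟩
    P p (xs ++ A)                    ≡⟨ P-++ xs A ⟩
    P p xs + P p A                   ∎
    where
    open ≤-Reasoning
    j∈xs++A : j ∈ xs ++ A
    j∈xs++A = [ id , ⊥-elim ∘ j∉ys ]′ (∈-++⁻ (xs ++ A) (subst (j ∈_) (sym (++-assoc xs A ys)) j∈))

  completion-sorted : ∀ {j} {xs} → AllPairs Fin._<_ xs → j ∈ xs →
                      completion p xs j ≡ P p (filter (λ k → k ≤?ᶠ j) xs)
  completion-sorted {j} {x ∷ xs} _ _ with x ≟ᶠ j
  completion-sorted {_} {x ∷ xs} (x<xs ∷ _) _ | yes refl = sym (begin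
    P p (filter (λ k → k ≤?ᶠ x) (x ∷ xs)) ≡⟨ cong (P p) (filter-accept (λ k → k ≤?ᶠ x) ≤-refl) ⟩
    p x + P p (filter (λ k → k ≤?ᶠ x) xs) ≡⟨ cong (λ ys → p x + P p ys) (filter-none (λ k → k ≤?ᶠ x) (All.map <⇒≱ x<xs)) ⟩
    p x + 0                               ≡⟨ +-identityʳ (p x) ⟩
    p x                                   ∎)
    where open ≡-Reasoning
  completion-sorted {_} {x ∷ xs} _ (here j≡x) | no x≢j = ⊥-elim (x≢j (sym j≡x))
  completion-sorted {j} {x ∷ xs} (x<xs ∷ sorted) (there j∈) | no _ = begin
    p x + completion p xs j               ≡⟨ cong (p x +_) (completion-sorted sorted j∈) ⟩
    p x + P p (filter (λ k → k ≤?ᶠ j) xs) ≡⟨ cong (P p) (filter-accept (λ k → k ≤?ᶠ j) (<⇒≤ (All.lookup x<xs j∈))) ⟨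
    P p (filter (λ k → k ≤?ᶠ j) (x ∷ xs)) ∎
    where open ≡-Reasoning

module _ {n m : ℕ} (σ : Fin n → Fin m) where

  jobsOn-sorted : ∀ x → AllPairs Fin._<_ (jobsOn σ x)
  jobsOn-sorted x = AllPairs.filter⁺ (λ k → σ k ≟ᶠ x) (AllPairs.tabulate⁺-< id)

  jobsAfter-unique : ∀ x j → Unique (jobsAfter σ x j)
  jobsAfter-unique x j = AllPairs.map Fin.<⇒≢ (AllPairs.filter⁺ (λ k → j <?ᶠ k) (jobsOn-sorted x))

  ∈-jobsOn⁻ : ∀ {j x} → j ∈ jobsOn σ x → σ j ≡ x
  ∈-jobsOn⁻ j∈ = proj₂ (∈-filter⁻ (λ k → σ k ≟ᶠ _) {xs = allFin n} j∈)

  ∈-jobsUpTo⁻ : ∀ {j x j′} → j ∈ jobsUpTo σ x j′ → σ j ≡ x × j Fin.≤ j′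
  ∈-jobsUpTo⁻ j∈ with ∈-filter⁻ (λ k → k ≤?ᶠ _) j∈
  ... | j∈on , j≤j′ = ∈-jobsOn⁻ j∈on , j≤j′

  ∈-jobsAfter⁻ : ∀ {j x j′} → j ∈ jobsAfter σ x j′ → σ j ≡ x × j′ Fin.< j
  ∈-jobsAfter⁻ j∈ with ∈-filter⁻ (λ k → _ <?ᶠ k) j∈
  ... | j∈on , j′<j = ∈-jobsOn⁻ j∈on , j′<j

  C≡P-jobsUpTo : ∀ (p : Fin n → ℕ) j → C p σ j ≡ P p (jobsUpTo σ (σ j) j)
  C≡P-jobsUpTo p j =
    completion-sorted p (jobsOn-sorted (σ j)) (∈-filter⁺ (λ k → σ k ≟ᶠ σ j) (∈-allFin j) refl)

module AdmissibleSwap {n m : ℕ} (p : Fin n → ℕ) (p≥1 : ∀ j → 1 ≤ p j)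
                      (σ : Fin n → Fin m) (j* : Fin n) (h i : Fin m)
                      (admissible : Swap.Admissible p σ j* h i) where

  open Swap p σ j* h i

  σj*≡h : σ j* ≡ h
  σj*≡h = proj₁ admissible

  P-jobsUpTo-gap : P p (jobsUpTo σ i j*) + 4 * (pmax p * pmax p) ≤ P p (jobsUpTo σ h j*)
  P-jobsUpTo-gap = proj₂ (proj₂ admissible)

  C-j*≡P-jobsUpTo-h : C p σ j* ≡ P p (jobsUpTo σ h j*)
  C-j*≡P-jobsUpTo-h = subst (λ x → C p σ j* ≡ P p (jobsUpTo σ x j*)) σj*≡h (C≡P-jobsUpTo σ p j*)

  h≢i : h ≢ i
  h≢i refl = <⇒≱ (m<m+n (P p (jobsUpTo σ h j*)) 0<4pmax²) P-jobsUpTo-gap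
    where
    pmax≥1 : 1 ≤ pmax p
    pmax≥1 = ≤-trans (p≥1 j*) (p≤pmax p j*)
    0<4pmax² : 0 < 4 * (pmax p * pmax p)
    0<4pmax² = *-mono-≤ {1} {4} (s≤s z≤n) (*-mono-≤ pmax≥1 pmax≥1)

  ∈-JH⁻ : ∀ {j} → j ∈ JH → σ j ≡ h × j Fin.≤ j*
  ∈-JH⁻ j∈ = ∈-jobsUpTo⁻ σ (drop⊆ cutH (jobsUpTo σ h j*) j∈)

  ∈-JI⁻ : ∀ {j} → j ∈ JI → σ j ≡ i × j* Fin.< j
  ∈-JI⁻ j∈ = ∈-jobsAfter⁻ σ (take⊆ two-pmax (jobsAfter σ i j*) j∈)

  ∈-JH++JI⇒σ≡h⊎σ≡i : ∀ {j} → j ∈ JH ++ JI → σ j ≡ h ⊎ σ j ≡ i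
  ∈-JH++JI⇒σ≡h⊎σ≡i j∈ = Sum.map (proj₁ ∘ ∈-JH⁻) (proj₁ ∘ ∈-JI⁻) (∈-++⁻ JH j∈)

  ∈-JH++JI⇒∉-jobsAfter-h : ∀ {j} → j ∈ JH ++ JI → j ∉ jobsAfter σ h j*
  ∈-JH++JI⇒∉-jobsAfter-h j∈ j∈after with ∈-jobsAfter⁻ σ j∈after | ∈-++⁻ JH j∈
  ... | _    , j*<j | inj₁ j∈JH = <⇒≱ j*<j (proj₂ (∈-JH⁻ j∈JH))
  ... | σj≡h , _    | inj₂ j∈JI = h≢i (trans (sym σj≡h) (proj₁ (∈-JI⁻ j∈JI)))

  ∈-JH++JI⇒∉-restI : ∀ {j} → j ∈ JH ++ JI → j ∉ restI
  ∈-JH++JI⇒∉-restI j∈ j∈rest with ∈-++⁻ JH j∈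
  ... | inj₁ j∈JH = h≢i (trans (sym (proj₁ (∈-JH⁻ j∈JH)))
                               (proj₁ (∈-jobsAfter⁻ σ (drop⊆ two-pmax (jobsAfter σ i j*) j∈rest))))
  ... | inj₂ j∈JI = take-drop-disjoint two-pmax (jobsAfter-unique σ i j*) (j∈JI , j∈rest)

  P-prefixH+P-JH : P p prefixH + P p JH ≡ P p (jobsUpTo σ h j*)
  P-prefixH+P-JH = trans (sym (P-++ p prefixH JH)) (cong (P p) (take++drop≡id cutH (jobsUpTo σ h j*)))

  P-JH≤ : P p JH ≤ two-pmax * pmax p
  P-JH≤ = ≤-trans (P≤length*pmax p JH) (*-monoˡ-≤ (pmax p) (length-drop-∸≤ two-pmax (jobsUpTo σ h j*)))

  P-JI≤ : P p JI ≤ two-pmax * pmax p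
  P-JI≤ = ≤-trans (P≤length*pmax p JI) (*-monoˡ-≤ (pmax p) (length-take≤ two-pmax (jobsAfter σ i j*)))

  module _ (SH SI : Fin n → Bool) (P-JH'≡P-JI' : P p (sel SH JH) ≡ P p (sel SI JI)) where

    open Choice SH SI

    P-JH''++JI'≡P-JH : P p (JH'' ++ JI') ≡ P p JH
    P-JH''++JI'≡P-JH = begin
      P p (JH'' ++ JI')   ≡⟨ P-++ p JH'' JI' ⟩
      P p JH'' + P p JI'  ≡⟨ cong (P p JH'' +_) P-JH'≡P-JI' ⟨
      P p JH'' + P p JH'  ≡⟨ +-comm (P p JH'') (P p JH') ⟩
      P p JH' + P p JH''  ≡⟨ P-sel+P-unsel p SH JH ⟩
      P p JH              ∎
      where open ≡-Reasoning

    P-JH'++JI''≤ : P p (JH' ++ JI'') ≤ 4 * (pmax p * pmax p)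
    P-JH'++JI''≤ = begin
      P p (JH' ++ JI'')                     ≡⟨ P-++ p JH' JI'' ⟩
      P p JH' + P p JI''                    ≤⟨ +-mono-≤ (P-sel≤ p SH JH) (P-unsel≤ p SI JI) ⟩
      P p JH + P p JI                       ≤⟨ +-mono-≤ P-JH≤ P-JI≤ ⟩
      two-pmax * pmax p + two-pmax * pmax p ≡⟨ solve 1 (λ x → con 2 :* x :* x :+ con 2 :* x :* x := con 4 :* (x :* x)) refl (pmax p) ⟩
      4 * (pmax p * pmax p)                 ∎
      where open ≤-Reasoning
            open +-*-Solver

    completion-h≤C-j* : ∀ {j} → j ∈ JH ++ JI → j ∈ prefixH ++ (JH'' ++ JI') ++ jobsAfter σ h j* →
                        completion p (prefixH ++ (JH'' ++ JI') ++ jobsAfter σ h j*) j ≤ C p σ j*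
    completion-h≤C-j* {j} j∈J j∈ = begin
      completion p (prefixH ++ (JH'' ++ JI') ++ jobsAfter σ h j*) j
        ≤⟨ completion-++-++≤ p prefixH (JH'' ++ JI') (jobsAfter σ h j*) j∈ (∈-JH++JI⇒∉-jobsAfter-h j∈J) ⟩
      P p prefixH + P p (JH'' ++ JI') ≡⟨ cong (P p prefixH +_) P-JH''++JI'≡P-JH ⟩
      P p prefixH + P p JH            ≡⟨ P-prefixH+P-JH ⟩
      P p (jobsUpTo σ h j*)           ≡⟨ C-j*≡P-jobsUpTo-h ⟨
      C p σ j*                        ∎
      where open ≤-Reasoning

    completion-i≤C-j* : ∀ {j} → j ∈ JH ++ JI → j ∈ jobsUpTo σ i j* ++ (JH' ++ JI'') ++ restI →
                        completion p (jobsUpTo σ i j* ++ (JH' ++ JI'') ++ restI) j ≤ C p σ j*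
    completion-i≤C-j* {j} j∈J j∈ = begin
      completion p (jobsUpTo σ i j* ++ (JH' ++ JI'') ++ restI) j
        ≤⟨ completion-++-++≤ p (jobsUpTo σ i j*) (JH' ++ JI'') restI j∈ (∈-JH++JI⇒∉-restI j∈J) ⟩
      P p (jobsUpTo σ i j*) + P p (JH' ++ JI'')      ≤⟨ +-monoʳ-≤ (P p (jobsUpTo σ i j*)) P-JH'++JI''≤ ⟩
      P p (jobsUpTo σ i j*) + 4 * (pmax p * pmax p)  ≤⟨ P-jobsUpTo-gap ⟩
      P p (jobsUpTo σ h j*)                          ≡⟨ C-j*≡P-jobsUpTo-h ⟨
      C p σ j*                                       ∎
      where open ≤-Reasoning

lemma6 : {n m : ℕ} (p : Fin n → ℕ) → (∀ j → 1 ≤ p j)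
       → (σ : Fin n → Fin m) (j* : Fin n) (h i : Fin m)
       → Swap.Admissible p σ j* h i
       → (SH SI : Fin n → Bool)
       → Swap.Choice.ValidChoice p σ j* h i SH SI
       → ∀ j → j ∈ (Swap.JH p σ j* h i ++ Swap.JI p σ j* h i)
       → ∀ k → j ∈ Swap.Choice.σ' p σ j* h i SH SI k
       → completion p (Swap.Choice.σ' p σ j* h i SH SI k) j ≤ C p σ j*
lemma6 p p≥1 σ j* h i admissible SH SI (_ , _ , P-JH'≡P-JI') j j∈J = completion-σ'≤C-j*
  where
  open AdmissibleSwap p p≥1 σ j* h i admissible
  open Swap.Choice p σ j* h i SH SI using (σ')

  completion-σ'≤C-j* : ∀ k → j ∈ σ' k → completion p (σ' k) j ≤ C p σ j*
  completion-σ'≤C-j* k with k ≟ᶠ h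
  ... | yes refl = completion-h≤C-j* SH SI P-JH'≡P-JI' j∈J
  ... | no k≢h with k ≟ᶠ i
  ...   | yes refl = completion-i≤C-j* SH SI P-JH'≡P-JI' j∈J
  ...   | no k≢i = λ j∈σ'k → let σj≡k = ∈-jobsOn⁻ σ j∈σ'k in
                   ⊥-elim ([ k≢h ∘ trans (sym σj≡k) , k≢i ∘ trans (sym σj≡k) ]′ (∈-JH++JI⇒σ≡h⊎σ≡i j∈J))
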